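{- For every term $M$ and all continuations $K_1, K_2$, $\underline{K_1}[\underline{K_2}[M]]=\underline{K_2[k:=K_1]}[M]$.
   Context: Syntax. Fix a ring of scalars; $\alpha$ ranges over it. Terms: $M,N ::= V \mid MN \mid \alpha.M \mid M+N$; values $V,W ::= B \mid 0 \mid \alpha.V \mid V+W$; base values $B ::= x \mid \lambda x.M$. Terms are taken up to $\alpha$-conversion and $M[x:=N]$ is capture-avoiding substitution. CPS grammar. Base computations $C ::= KB \mid B_1B_2K \mid TK$; computation combinations $D ::= C \mid 0 \mid \alpha.D \mid D_1+D_2$; base suspensions $S ::= \lambda k.C$; suspension combinations $T ::= S \mid 0\mid \alpha.T \mid T_1+T_2$; continuations $K ::= k \mid \lambda b.BbK \mid \lambda b_1.T(\lambda b_2.b_1b_2K)$; CPS-values $B ::= x \mid \lambda x.S$. Here $k,b,b_1,b_2$ are reserved variables distinct from ordinary variables $x$; $k$ occurs only as the continuation $k$ and as the binder in $\lambda k.C$; $b,b_1,b_2$ occur only where displayed. Inverse translation: $\overline{KB}=\underline{K}[\psi(B)]$; $\overline{B_1B_2K}=\underline{K}[\psi(B_1)\psi(B_2)]$; $\overline{TK}=\underline{K}[\sigma(T)]$; $\overline{0}=0$; $\overline{\alpha.D}=\alpha.\overline{D}$; $\overline{D_1+D_2}=\overline{D_1}+\overline{D_2}$; $\sigma(\lambda k.C)=\overline{C}$; $\sigma(0)=0$; $\sigma(\alpha.T)=\alpha.\sigma(T)$; $\sigma(T_1+T_2)=\sigma(T_1)+\sigma(T_2)$; $\psi(x)=x$;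 $\psi(\lambda x.S)=\lambda x.\sigma(S)$; for a term $M$: $\underline{k}[M]=M$; $\underline{\lambda b.BbK}[M]=\underline{K}[\psi(B)M]$; $\underline{\lambda b_1.T(\lambda b_2.b_1b_2K)}[M]=\underline{K}[M\,\sigma(T)]$. -}

module Defs where

open import Level using (Level)
open import Data.Nat using (ℕ)

-- Ordinary variables x are de Bruijn indices (so terms are taken up to
-- alpha-conversion and syntactic equality _≡_ is alpha-equivalence).
-- The reserved variables k, b, b₁, b₂ are not represented by names: by the
-- grammar they only occur in the fixed displayed positions, so they are
-- encoded by the shape of the constructors below.

module _ {a : Level} (A : Set a) where

  data Term : Set a where
    var  : ℕ → Term
    lam  : Term → Term
    app  : Term → Term → Term
    zero : Term
    smul : A → Term → Term
    plus : Term → Term → Term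

  mutual
    data Comp : Set a where
      cKB  : Cont → CVal → Comp
      cBBK : CVal → CVal → Cont → Comp
      cTK  : Susp → Cont → Comp

    data Susp : Set a where
      lamk  : Comp → Susp
      szero : Susp
      ssmul : A → Susp → Susp
      splus : Susp → Susp → Susp

    -- Continuations  K ::= k | λb.B b K | λb₁.T (λb₂.b₁ b₂ K)
    data Cont : Set a where
      kvar : Cont
      kB   : CVal → Cont → Cont
      kT   : Susp → Cont → Cont

    data CVal : Set a where
      cvar : ℕ → CVal
      clam : Comp → CVal     -- clam C  represents  λx.λk.C

  data CompComb : Set a where
    dC    : Comp → CompComb
    dzero : CompComb
    dsmul : A → CompComb → CompComb
    dplus : CompComb → CompComb → CompComb

  -- Every occurrence of k inside a CPS-value B or a
  -- suspension T is bound by some λk, so the only free occurrence of k in a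
  -- continuation is its tail; no ordinary variable is bound along the spine,
  -- hence the substitution is capture-avoiding.
  _[k≔_] : Cont → Cont → Cont
  kvar     [k≔ K₁ ] = K₁
  kB B K   [k≔ K₁ ] = kB B (K [k≔ K₁ ])
  kT T K   [k≔ K₁ ] = kT T (K [k≔ K₁ ])

  mutual
    ovC : Comp → Term
    ovC (cKB K B)      = und K (ψ B)
    ovC (cBBK B₁ B₂ K) = und K (app (ψ B₁) (ψ B₂))
    ovC (cTK T K)      = und K (σ T)

    σ : Susp → Term
    σ (lamk C)      = ovC C
    σ szero         = zero
    σ (ssmul α T)   = smul α (σ T)
    σ (splus T₁ T₂) = plus (σ T₁) (σ T₂)

    ψ : CVal → Term
    ψ (cvar x) = var x
    ψ (clam C) = lam (ovC C)     -- ψ(λx.λk.C) = λx.σ(λk.C) = λx.\overline{C}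

    und : Cont → Term → Term
    und kvar     M = M
    und (kB B K) M = und K (app (ψ B) M)
    und (kT T K) M = und K (app M (σ T))

  ovD : CompComb → Term
  ovD (dC C)        = ovC C
  ovD dzero         = zero
  ovD (dsmul α D)   = smul α (ovD D)
  ovD (dplus D₁ D₂) = plus (ovD D₁) (ovD D₂)

module Submission where

-- A continuation K is a spine of frames ending in the continuation variable k,
-- and K[k := K₁] grafts K₁ onto that tail.  The context \underline{K}[-]
-- applies the frames of K from the innermost outward and then stops at k, so
-- filling the context of K[k := K₁] is the same as first filling K and then
-- filling K₁ with the result.  The proof is an induction on the spine of K,
-- generalising over the term being plugged in, since each frame changes it.
--
-- Nothing about the scalars is used, so the fact is proved first for an
-- arbitrary carrier set (und-graft); lemma3p9 is its instance at the carrier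
-- of a ring.

open import Defs
open import Level using (Level)
open import Algebra.Bundles using (Ring)
open import Relation.Binary.PropositionalEquality using (_≡_; refl)

und-graft : {a : Level} {A : Set a} (K₁ K : Cont A) (M : Term A) →
  und A K₁ (und A K M) ≡ und A (_[k≔_] A K K₁) M
und-graft K₁ kvar     M = refl
und-graft K₁ (kB B K) M = und-graft K₁ K (app (ψ _ B) M)
und-graft K₁ (kT T K) M = und-graft K₁ K (app M (σ _ T))

lemma3p9 : {c ℓ : Level} (R : Ring c ℓ) (M : Term (Ring.Carrier R))
    (K₁ K₂ : Cont (Ring.Carrier R)) →
    und _ K₁ (und _ K₂ M) ≡ und _ (_[k≔_] _ K₂ K₁) M
lemma3p9 R M K₁ K₂ = und-graft K₁ K₂ M
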